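{- Let $M=[0,m_1]\times\cdots\times[0,m_d]$ with $m_i$ positive integers, let $H$ be a maximal system of brick islands in $M$ with $|Max(H)|>1$, and let $E$ be an edge of $M$. Suppose $R_1,R_2\in Max(H)$ both intersect $E$, and let the gap between $R_1$ and $R_2$ on $E$ be the open segment of $E$ lying strictly between the segments $R_1\cap E$ and $R_2\cap E$. Suppose no other member of $Max(H)$ intersects this gap. Then the length of the gap is at most $2$. Further, if the length of the gap is exactly $2$, neither $R_1$ nor $R_2$ is an elementary cube.
   Context: A brick of $M$ is a set $[a_1,b_1]\times\cdots\times[a_d,b_d]$ with $a_i,b_i\in\mathbb{Z}$, $0\le a_i<b_i\le m_i$. A system of brick islands in $M$ is a set $H$ of bricks of $M$ such that any two members are either nested or disjoint; it is maximal if it is not properly contained in another system of brick islands in $M$. For such $H$, $Max(H)$ denotes the set of maximal elements of $H\setminus\{M\}$ with respect to inclusion. An elementary cube of $M$ is a brick of the form $[a_1,a_1+1]\times\cdots\times[a_d,a_d+1]$. -}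

module Defs where

open import Data.Nat using (ℕ; zero; suc; _≤_; _<_; _⊓_; _⊔_; _∸_)
open import Data.Fin using (Fin)
open import Data.Vec using (Vec; lookup; replicate)
open import Data.Bool using (Bool; if_then_else_)
open import Data.Product using (Σ; ∃; _×_)
open import Data.Sum using (_⊎_)
open import Relation.Nullary using (¬_)
open import Relation.Binary.PropositionalEquality using (_≡_; _≢_)

-- A (candidate) brick  [lo 0, hi 0] × ⋯ × [lo (d-1), hi (d-1)]  given by its
-- integer corner coordinates (vectors, so that _≡_ on bricks is the
-- extensional equality of the corresponding point sets).
record Brick (d : ℕ) : Set where
  constructor brick
  field
    lo : Vec ℕ d
    hi : Vec ℕ d
open Brick public

a : ∀ {d} → Brick d → Fin d → ℕ
a B i = lookup (lo B) i

b : ∀ {d} → Brick d → Fin d → ℕ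
b B i = lookup (hi B) i

IsBrickOf : ∀ {d} → Vec ℕ d → Brick d → Set
IsBrickOf m B = ∀ i → a B i < b B i × b B i ≤ lookup m i

Whole : ∀ {d} → Vec ℕ d → Brick d
Whole {d} m = brick (replicate d 0) m

_⊆ᴮ_ : ∀ {d} → Brick d → Brick d → Set
B ⊆ᴮ C = ∀ i → a C i ≤ a B i × b B i ≤ b C i

Disjoint : ∀ {d} → Brick d → Brick d → Set
Disjoint B C = ∃ λ i → (b B i < a C i) ⊎ (b C i < a B i)

NestedOrDisjoint : ∀ {d} → Brick d → Brick d → Set
NestedOrDisjoint B C = B ⊆ᴮ C ⊎ C ⊆ᴮ B ⊎ Disjoint B C

BrickSet : ℕ → Set₁
BrickSet d = Brick d → Set

IsSystem : ∀ {d} → Vec ℕ d → BrickSet d → Set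
IsSystem m H =
  (∀ B → H B → IsBrickOf m B) ×
  (∀ B C → H B → H C → NestedOrDisjoint B C)

IsMaximalSystem : ∀ {d} → Vec ℕ d → BrickSet d → Set₁
IsMaximalSystem {d} m H =
  IsSystem m H ×
  ¬ (Σ (BrickSet d) λ H' → IsSystem m H' × (∀ B → H B → H' B) ×
       (∃ λ B → H' B × ¬ H B))

InMax : ∀ {d} → Vec ℕ d → BrickSet d → Brick d → Set
InMax m H R =
  H R × R ≢ Whole m ×
  (∀ S → H S → S ≢ Whole m → R ⊆ᴮ S → S ≡ R)

-- An edge of M: direction j, and for each i ≠ j a choice of the endpoint
-- 0 (false) or m_i (true); the edge is {x | x_j ∈ [0,m_j], x_i = fixed_i (i ≠ j)}.
-- (The value of corner at j is irrelevant.)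
record Edge (d : ℕ) : Set where
  constructor edge
  field
    dir    : Fin d
    corner : Fin d → Bool
open Edge public

fixedCoord : ∀ {d} → Vec ℕ d → Edge d → Fin d → ℕ
fixedCoord m E i = if corner E i then lookup m i else 0

-- R intersects the edge E (then R ∩ E is the segment [a_j, b_j] on E)
Meets : ∀ {d} → Vec ℕ d → Edge d → Brick d → Set
Meets m E R = ∀ i → i ≢ dir E → a R i ≤ fixedCoord m E i × fixedCoord m E i ≤ b R i

-- For distinct (hence disjoint) R1, R2 meeting E, the gap is the open segment
-- (gapLo, gapHi) of E along direction j = dir E.
gapLo : ∀ {d} → Edge d → Brick d → Brick d → ℕ
gapLo E R₁ R₂ = b R₁ (dir E) ⊓ b R₂ (dir E)

gapHi : ∀ {d} → Edge d → Brick d → Brick d → ℕ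
gapHi E R₁ R₂ = a R₁ (dir E) ⊔ a R₂ (dir E)

gapLength : ∀ {d} → Edge d → Brick d → Brick d → ℕ
gapLength E R₁ R₂ = gapHi E R₁ R₂ ∸ gapLo E R₁ R₂

MeetsGap : ∀ {d} → Vec ℕ d → Edge d → Brick d → Brick d → Brick d → Set
MeetsGap m E R₁ R₂ R =
  Meets m E R × a R (dir E) < gapHi E R₁ R₂ × gapLo E R₁ R₂ < b R (dir E)

ElementaryCube : ∀ {d} → Brick d → Set
ElementaryCube B = ∀ i → b B i ≡ suc (a B i)

module Submission where

-- Let j be the direction of the edge E and f i its fixed coordinate in each
-- transverse direction i ≠ j (always 0 or m_i).  Two distinct members of
-- Max(H) meeting E are separated along j; let the left one end at g and the
-- right one start at h.  Call a brick near E if each of its transverse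
-- intervals comes within distance 1 of f i.  The heart of the proof is that
-- no member of H ∖ {M} near E lies strictly inside (g,h): a counterexample
-- that is maximal among such bricks (well-founded induction on a measure that
-- drops under proper enlargement) belongs to Max(H), and its hull with the
-- line of E can then be added to H, contradicting maximality of H.  If
-- h ≥ g + 3, the unit cube [g+1,g+2] in the corner of E could be added to H;
-- so h ≤ g + 2.  If h = g + 2 and a neighbour is an elementary cube, the cube
-- stretched by one unit into the gap could likewise be added to H.

open import Defs
open import Function using (_∘_)
open import Data.Nat using (ℕ; zero; suc; z≤n; s≤s; s≤s⁻¹; _≤_; _<_; _⊓_; _⊔_; _∸_; _+_; _≟_; _<?_)
open import Data.Nat.Properties
open import Data.Nat.Induction using (<-wellFounded)
open import Induction.WellFounded using (Acc; acc)
open import Data.Vec using (Vec; []; _∷_; lookup; tabulate; sum; _[_]≔_)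
open import Data.Vec.Properties using (lookup-replicate; lookup∘tabulate; lookup∘update; lookup∘update′; ≡-dec)
import Data.Fin as Fin
open import Data.Fin using (Fin) renaming (_≟_ to _≟ᶠ_)
open import Data.Fin.Properties using (any?)
open import Data.Bool using (true; false)
open import Data.Product using (∃; _×_; _,_; proj₁; proj₂; map₂) renaming (swap to ×-swap)
open import Data.Sum using (_⊎_; inj₁; inj₂; [_,_]) renaming (swap to ⊎-swap; map to ⊎-map)
open import Data.Empty using (⊥; ⊥-elim)
open import Relation.Nullary using (¬_; Dec; yes; no)
open import Relation.Nullary.Decidable using (_⊎-dec_)
open import Relation.Binary.PropositionalEquality using (_≡_; _≢_; refl; sym; trans; cong; cong₂; subst; subst₂)

private variable
  d : ℕ
  B C D S X R₁ R₂ : Brick d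

Apart : ℕ → ℕ → ℕ → ℕ → Set
Apart p q r s = q < r ⊎ s < p

Overlap : ℕ → ℕ → ℕ → ℕ → Set
Overlap p q r s = r ≤ q × p ≤ s

overlap⇒¬apart : ∀ {p q r s} → Overlap p q r s → ¬ Apart p q r s
overlap⇒¬apart (r≤q , _) (inj₁ q<r) = <⇒≱ q<r r≤q
overlap⇒¬apart (_ , p≤s) (inj₂ s<p) = <⇒≱ s<p p≤s

¬apart⇒overlap : ∀ {p q r s} → ¬ Apart p q r s → Overlap p q r s
¬apart⇒overlap ¬ap = ≮⇒≥ (¬ap ∘ inj₁) , ≮⇒≥ (¬ap ∘ inj₂)

NearPt : ℕ → ℕ → ℕ → Set
NearPt f p q = p ≤ suc f × f ≤ suc q

-- The integer one step from a boundary point of [0,n] towards the interior.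
pivot : ℕ → ℕ
pivot zero    = 1
pivot (suc k) = k

near⇒pivot : ∀ {f n p q} → f ≡ 0 ⊎ f ≡ n → NearPt f p q → p < q → q ≤ n →
  p ≤ pivot f × pivot f ≤ q
near⇒pivot {zero}  _           (p≤1 , _)     p<q _   = p≤1 , ≤-trans (s≤s z≤n) p<q
near⇒pivot {suc k} (inj₁ ())
near⇒pivot {suc k} (inj₂ refl) (_ , f≤1+q) p<q q≤n = s≤s⁻¹ (<-≤-trans p<q q≤n) , s≤s⁻¹ f≤1+q

near⇒¬apart : ∀ {f n p q r s} → f ≡ 0 ⊎ f ≡ n →
  NearPt f p q → p < q → q ≤ n → NearPt f r s → r < s → s ≤ n → ¬ Apart p q r s
near⇒¬apart bd np p<q q≤n nr r<s s≤n =
  let (p≤c , c≤q) = near⇒pivot bd np p<q q≤n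
      (r≤c , c≤s) = near⇒pivot bd nr r<s s≤n
  in overlap⇒¬apart (≤-trans r≤c c≤q , ≤-trans p≤c c≤s)

hull⇒¬apart : ∀ {f n p q r s} → f ≡ 0 ⊎ f ≡ n → NearPt f p q → p < q → q ≤ n →
  r < s → s ≤ n → Overlap r s (p ⊓ f) (q ⊔ f) → ¬ Apart r s p q
hull⇒¬apart {zero}         _ (p≤1 , _) _ _ r<s _ _ (inj₁ s<p) =
  <⇒≱ (<-≤-trans s<p p≤1) (≤-trans (s≤s z≤n) r<s)
hull⇒¬apart {zero} {q = q} _ _ _ _ _ _ (_ , r≤q⊔0) (inj₂ q<r) =
  <⇒≱ q<r (subst (_ ≤_) (⊔-identityʳ q) r≤q⊔0)
hull⇒¬apart {suc k} (inj₁ ())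
hull⇒¬apart {suc k} (inj₂ refl) _ p<q q≤n _ _ (p⊓n≤s , _) (inj₁ s<p) =
  <⇒≱ s<p (subst (_≤ _) (m≤n⇒m⊓n≡m (<⇒≤ (<-≤-trans p<q q≤n))) p⊓n≤s)
hull⇒¬apart {suc k} (inj₂ refl) (_ , n≤1+q) _ _ r<s s≤n _ (inj₂ q<r) =
  <⇒≱ (<-≤-trans r<s s≤n) (≤-trans n≤1+q q<r)

step-in : ∀ {f n} → 0 < n → f ≤ n → suc (f ∸ 1) ≤ n
step-in {zero}  0<n _   = 0<n
step-in {suc _} _   f≤n = f≤n

⊆-refl : B ⊆ᴮ B
⊆-refl i = ≤-refl , ≤-refl

⊆-trans : B ⊆ᴮ C → C ⊆ᴮ D → B ⊆ᴮ D
⊆-trans B⊆C C⊆D i = ≤-trans (proj₁ (C⊆D i)) (proj₁ (B⊆C i)) , ≤-trans (proj₂ (B⊆C i)) (proj₂ (C⊆D i))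

nestedOrDisjoint-sym : NestedOrDisjoint B C → NestedOrDisjoint C B
nestedOrDisjoint-sym (inj₁ B⊆C)            = inj₂ (inj₁ B⊆C)
nestedOrDisjoint-sym (inj₂ (inj₁ C⊆B))     = inj₁ C⊆B
nestedOrDisjoint-sym (inj₂ (inj₂ (k , ap))) = inj₂ (inj₂ (k , ⊎-swap ap))

Touch : Brick d → Brick d → Set
Touch S D = ∀ k → Overlap (a S k) (b S k) (a D k) (b D k)

touch-refl : ∀ {m : Vec ℕ d} → IsBrickOf m B → Touch B B
touch-refl bB k = <⇒≤ (proj₁ (bB k)) , <⇒≤ (proj₁ (bB k))

disjoint-or-touch : (S D : Brick d) → Disjoint S D ⊎ Touch S D
disjoint-or-touch S D with any? (λ k → (b S k <? a D k) ⊎-dec (b D k <? a S k))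
... | yes dj  = inj₁ dj
... | no ¬dj = inj₂ (λ k → ¬apart⇒overlap (λ ap → ¬dj (k , ap)))

brick-≟ : (B C : Brick d) → Dec (B ≡ C)
brick-≟ (brick l h) (brick l′ h′) with ≡-dec _≟_ l l′ | ≡-dec _≟_ h h′
... | yes refl | yes refl = yes refl
... | no l≢l′  | _        = no (λ { refl → l≢l′ refl })
... | yes _    | no h≢h′  = no (λ { refl → h≢h′ refl })

differ-at : ∀ i → a B i ≢ a C i ⊎ b B i ≢ b C i → B ≢ C
differ-at i (inj₁ a≢) refl = a≢ refl
differ-at i (inj₂ b≢) refl = b≢ refl

Whole-a : ∀ (m : Vec ℕ d) i → a (Whole m) i ≡ 0
Whole-a m i = lookup-replicate i 0

⊆-Whole : ∀ {m : Vec ℕ d} → IsBrickOf m D → D ⊆ᴮ Whole m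
⊆-Whole {D = D} {m = m} bD i = subst (_≤ a D i) (sym (Whole-a m i)) z≤n , proj₂ (bD i)

sum-mono : ∀ {n} (u v : Vec ℕ n) → (∀ i → lookup u i ≤ lookup v i) → sum u ≤ sum v
sum-mono []      []      _   = z≤n
sum-mono (x ∷ u) (y ∷ v) u≤v = +-mono-≤ (u≤v Fin.zero) (sum-mono u v (u≤v ∘ Fin.suc))

sum-strict : ∀ {n} (u v : Vec ℕ n) → (∀ i → lookup u i ≤ lookup v i) → u ≢ v → sum u < sum v
sum-strict []      []      _   u≢v = ⊥-elim (u≢v refl)
sum-strict (x ∷ u) (y ∷ v) u≤v u≢v with x ≟ y
... | yes refl = +-monoʳ-< x (sum-strict u v (u≤v ∘ Fin.suc) (u≢v ∘ cong (x ∷_)))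
... | no x≢y   = +-mono-<-≤ (≤∧≢⇒< (u≤v Fin.zero) x≢y) (sum-mono u v (u≤v ∘ Fin.suc))

-- How far B is from filling M = [0,m]; it drops strictly under proper enlargement.
slack : Vec ℕ d → Brick d → ℕ
slack m B = sum (lo B) + (sum m ∸ sum (hi B))

slack-shrinks : ∀ (m : Vec ℕ d) → IsBrickOf m S → B ⊆ᴮ S → S ≢ B → slack m S < slack m B
slack-shrinks {S = brick lS hS} {B = brick lB hB} m bS B⊆S S≢B with ≡-dec _≟_ lS lB
... | no lS≢lB = +-mono-<-≤ (sum-strict lS lB (proj₁ ∘ B⊆S) lS≢lB)
                            (∸-monoʳ-≤ (sum m) (sum-mono hB hS (proj₂ ∘ B⊆S)))
... | yes refl = +-monoʳ-< (sum lS)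
                   (∸-monoʳ-< (sum-strict hB hS (proj₂ ∘ B⊆S) (λ { refl → S≢B refl }))
                              (sum-mono hS m (proj₂ ∘ bS)))

module MaximalSystem {d} (m : Vec ℕ d) {H : BrickSet d} (maxH : IsMaximalSystem m H) where

  member-brick : ∀ B → H B → IsBrickOf m B
  member-brick = proj₁ (proj₁ maxH)

  compatible : ∀ B C → H B → H C → NestedOrDisjoint B C
  compatible = proj₂ (proj₁ maxH)

  compatible⇒member : IsBrickOf m D → (∀ S → H S → NestedOrDisjoint S D) → ¬ ¬ H D
  compatible⇒member {D} bD compat ¬HD =
    proj₂ maxH (H′ , (bricks′ , compat′) , (λ _ → inj₁) , D , inj₂ refl , ¬HD)
    where
    H′ : BrickSet d
    H′ X = H X ⊎ X ≡ D
    bricks′ : ∀ X → H′ X → IsBrickOf m X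
    bricks′ X (inj₁ hX)  = member-brick X hX
    bricks′ X (inj₂ refl) = bD
    compat′ : ∀ X Y → H′ X → H′ Y → NestedOrDisjoint X Y
    compat′ X Y (inj₁ hX)   (inj₁ hY)   = compatible X Y hX hY
    compat′ X Y (inj₁ hX)   (inj₂ refl) = compat X hX
    compat′ X Y (inj₂ refl) (inj₁ hY)   = nestedOrDisjoint-sym {B = Y} {C = D} (compat Y hY)
    compat′ X Y (inj₂ refl) (inj₂ refl) = inj₁ (⊆-refl {B = D})

  outside⇒touched : IsBrickOf m D → ¬ H D → (∀ S → H S → S ≢ Whole m → ¬ Touch S D) → ⊥
  outside⇒touched {D} bD ¬HD untouched = compatible⇒member bD compat ¬HD
    where
    compat : ∀ S → H S → NestedOrDisjoint S D
    compat S hS with brick-≟ S (Whole m) | disjoint-or-touch S D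
    ... | yes refl | _        = inj₂ (inj₁ (⊆-Whole {D = D} {m = m} bD))
    ... | no _     | inj₁ dj  = inj₂ (inj₂ dj)
    ... | no S≢M   | inj₂ t   = ⊥-elim (untouched S hS S≢M t)

  enlargement-blocked : InMax m H B → B ⊆ᴮ D → IsBrickOf m D → D ≢ Whole m → D ≢ B →
    (∀ S → H S → S ≢ Whole m → Disjoint S B → ¬ Touch S D) → ⊥
  enlargement-blocked {B} {D} (hB , _ , sup) B⊆D bD D≢M D≢B blocked =
    compatible⇒member bD compat (λ hD → D≢B (sup D hD D≢M B⊆D))
    where
    compat : ∀ S → H S → NestedOrDisjoint S D
    compat S hS with brick-≟ S (Whole m)
    ... | yes refl = inj₂ (inj₁ (⊆-Whole {D = D} {m = m} bD))
    ... | no S≢M with compatible S B hS hB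
    ...   | inj₁ S⊆B        = inj₁ (⊆-trans {B = S} {C = B} {D = D} S⊆B B⊆D)
    ...   | inj₂ (inj₁ B⊆S) = inj₁ (subst (_⊆ᴮ D) (sym (sup S hS S≢M B⊆S)) B⊆D)
    ...   | inj₂ (inj₂ dj) with disjoint-or-touch S D
    ...     | inj₁ dj′ = inj₂ (inj₂ dj′)
    ...     | inj₂ t   = ⊥-elim (blocked S hS S≢M dj t)

module EdgeGeometry {d} (m : Vec ℕ d) (E : Edge d) where

  j : Fin d
  j = dir E

  f : Fin d → ℕ
  f = fixedCoord m E

  f-boundary : ∀ i → f i ≡ 0 ⊎ f i ≡ lookup m i
  f-boundary i with corner E i
  ... | true  = inj₂ refl
  ... | false = inj₁ refl

  f≤m : ∀ i → f i ≤ lookup m i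
  f≤m i with f-boundary i
  ... | inj₁ f≡0 = subst (_≤ lookup m i) (sym f≡0) z≤n
  ... | inj₂ f≡m = ≤-reflexive f≡m

  Near : Brick d → Set
  Near S = ∀ i → i ≢ j → NearPt (f i) (a S i) (b S i)

  meets⇒near : Meets m E S → Near S
  meets⇒near mS i i≢j = ≤-trans (proj₁ (mS i i≢j)) (n≤1+n _) , ≤-trans (proj₂ (mS i i≢j)) (n≤1+n _)

  near-⊆ : Near B → B ⊆ᴮ S → Near S
  near-⊆ nB B⊆S i i≢j = ≤-trans (proj₁ (B⊆S i)) (proj₁ (nB i i≢j))
                       , ≤-trans (proj₂ (nB i i≢j)) (s≤s (proj₂ (B⊆S i)))

  near⇒¬apartᵗ : ∀ {k} → IsBrickOf m S → IsBrickOf m X → Near S → Near X → k ≢ j →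
    ¬ Apart (a S k) (b S k) (a X k) (b X k)
  near⇒¬apartᵗ {k = k} bS bX nS nX k≢j =
    near⇒¬apart (f-boundary k) (nS k k≢j) (proj₁ (bS k)) (proj₂ (bS k))
                               (nX k k≢j) (proj₁ (bX k)) (proj₂ (bX k))

  slab : ℕ → ℕ → (Fin d → ℕ) → (Fin d → ℕ) → Brick d
  slab x y l u = brick (tabulate l [ j ]≔ x) (tabulate u [ j ]≔ y)

  module _ {x y : ℕ} {l u : Fin d → ℕ} where

    slab-along : a (slab x y l u) j ≡ x × b (slab x y l u) j ≡ y
    slab-along = lookup∘update j (tabulate l) x , lookup∘update j (tabulate u) y

    slab-across : ∀ {i} → i ≢ j → a (slab x y l u) i ≡ l i × b (slab x y l u) i ≡ u i
    slab-across {i} i≢j = trans (lookup∘update′ i≢j (tabulate l) x) (lookup∘tabulate l i)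
                        , trans (lookup∘update′ i≢j (tabulate u) y) (lookup∘tabulate u i)

    slab-intro : (P : Fin d → ℕ → ℕ → Set) → P j x y → (∀ i → i ≢ j → P i (l i) (u i)) →
      ∀ i → P i (a (slab x y l u) i) (b (slab x y l u) i)
    slab-intro P pj pt i with i ≟ᶠ j
    ... | yes refl = subst₂ (P j) (sym (proj₁ slab-along)) (sym (proj₂ slab-along)) pj
    ... | no i≢j   = subst₂ (P i) (sym (proj₁ (slab-across i≢j))) (sym (proj₂ (slab-across i≢j))) (pt i i≢j)

    slab-elim : (P : Fin d → ℕ → ℕ → Set) → (∀ i → P i (a (slab x y l u) i) (b (slab x y l u) i)) →
      P j x y × (∀ i → i ≢ j → P i (l i) (u i))
    slab-elim P p = subst₂ (P j) (proj₁ slab-along) (proj₂ slab-along) (p j)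
                  , λ i i≢j → subst₂ (P i) (proj₁ (slab-across i≢j)) (proj₂ (slab-across i≢j)) (p i)

  hull : Brick d → Brick d
  hull B = slab (a B j) (b B j) (λ i → a B i ⊓ f i) (λ i → b B i ⊔ f i)

  hull-brick : IsBrickOf m B → IsBrickOf m (hull B)
  hull-brick {B} bB = slab-intro (λ i p q → p < q × q ≤ lookup m i) (bB j)
    (λ i _ → ≤-<-trans (m⊓n≤m _ _) (<-≤-trans (proj₁ (bB i)) (m≤m⊔n _ _))
           , ⊔-lub (proj₂ (bB i)) (f≤m i))

  ⊆-hull : B ⊆ᴮ hull B
  ⊆-hull {B} = slab-intro (λ i p q → p ≤ a B i × b B i ≤ q) (≤-refl , ≤-refl)
    (λ _ _ → m⊓n≤m _ _ , m≤m⊔n _ _)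

  hull-along : a (hull B) j ≡ a B j
  hull-along {B} = proj₁ (slab-along {a B j} {b B j} {λ i → a B i ⊓ f i} {λ i → b B i ⊔ f i})

  hull-across : ∀ {i} → i ≢ j → a (hull B) i ≡ a B i ⊓ f i × b (hull B) i ≡ b B i ⊔ f i
  hull-across {B} = slab-across {a B j} {b B j} {λ i → a B i ⊓ f i} {λ i → b B i ⊔ f i}

  hull-meets : Meets m E (hull B)
  hull-meets {B} i i≢j =
    subst (_≤ f i) (sym (proj₁ (hull-across {B} i≢j))) (m⊓n≤n _ _)
    , subst (f i ≤_) (sym (proj₂ (hull-across {B} i≢j))) (m≤n⊔m _ _)

  hull-touch : IsBrickOf m B → Near B → IsBrickOf m S → Touch S (hull B) → ¬ Disjoint S B
  hull-touch {B} {S} bB nB bS t (k , ap) with slab-elim (λ i p q → Overlap (a S i) (b S i) p q) t | k ≟ᶠ j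
  ... | (ovj , _) | yes refl = overlap⇒¬apart ovj ap
  ... | (_ , ovt) | no k≢j   =
    hull⇒¬apart (f-boundary k) (nB k k≢j) (proj₁ (bB k)) (proj₂ (bB k))
                (proj₁ (bS k)) (proj₂ (bS k)) (ovt k k≢j) ap

  thinSlab : ℕ → ℕ → (Fin d → ℕ) → Brick d
  thinSlab x y l = slab x y l (suc ∘ l)

  touch-thin⇒near : ∀ {x y l} → (∀ i → i ≢ j → l i ≤ f i × f i ≤ suc (l i)) →
    Touch S (thinSlab x y l) → Near S
  touch-thin⇒near {S} {l = l} lf t i i≢j =
    let (l≤bS , aS≤1+l) = proj₂ (slab-elim (λ k p q → Overlap (a S k) (b S k) p q) t) i i≢j
    in ≤-trans aS≤1+l (s≤s (proj₁ (lf i i≢j))) , ≤-trans (proj₂ (lf i i≢j)) (s≤s l≤bS)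

  cornerCube : ℕ → Brick d
  cornerCube x = thinSlab x (suc x) (λ i → f i ∸ 1)

  cornerCube-hugs : ∀ i → i ≢ j → f i ∸ 1 ≤ f i × f i ≤ suc (f i ∸ 1)
  cornerCube-hugs i _ = m∸n≤m (f i) 1 , m≤n+m∸n (f i) 1

  cornerCube-brick : ∀ {x} → (∀ i → 0 < lookup m i) → suc x ≤ lookup m j → IsBrickOf m (cornerCube x)
  cornerCube-brick {x} pos x<m = slab-intro (λ i p q → p < q × q ≤ lookup m i) (n<1+n x , x<m)
    (λ i _ → n<1+n _ , step-in (pos i) (f≤m i))

  cornerCube-along : ∀ {x} → a (cornerCube x) j ≡ x × b (cornerCube x) j ≡ suc x
  cornerCube-along {x} = slab-along {x} {suc x} {λ i → f i ∸ 1} {λ i → suc (f i ∸ 1)}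

gapLength-comm : ∀ (E : Edge d) (R₁ R₂ : Brick d) → gapLength E R₁ R₂ ≡ gapLength E R₂ R₁
gapLength-comm E R₁ R₂ = cong₂ _∸_ (⊔-comm (a R₁ (dir E)) _) (⊓-comm (b R₁ (dir E)) _)

meetsGap-comm : ∀ {m : Vec ℕ d} {E : Edge d} → MeetsGap m E R₂ R₁ S → MeetsGap m E R₁ R₂ S
meetsGap-comm {R₂ = R₂} {R₁ = R₁} {S = S} {E = E} (mS , a<hi , lo<b) =
  mS , subst (a S (dir E) <_) (⊔-comm (a R₂ (dir E)) _) a<hi
     , subst (_< b S (dir E)) (⊓-comm (b R₂ (dir E)) _) lo<b

GapConclusion : Brick d → Brick d → ℕ → Set
GapConclusion R₁ R₂ n = n ≤ 2 × (n ≡ 2 → ¬ ElementaryCube R₁ × ¬ ElementaryCube R₂)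

gapConclusion-swap : ∀ {n} → GapConclusion R₂ R₁ n → GapConclusion R₁ R₂ n
gapConclusion-swap = map₂ (λ cubes len≡2 → ×-swap (cubes len≡2))

module GapArgument {d} (m : Vec ℕ d) (pos : ∀ i → 0 < lookup m i)
                   {H : BrickSet d} (maxH : IsMaximalSystem m H) (E : Edge d) where

  open MaximalSystem m maxH
  open EdgeGeometry m E

  alongEdge : InMax m H X → Meets m E X → H S → S ≢ Whole m → Near S →
    S ⊆ᴮ X ⊎ Apart (a S j) (b S j) (a X j) (b X j)
  alongEdge {X} {S} (hX , _ , supX) mX hS S≢M nS with compatible S X hS hX
  ... | inj₁ S⊆X        = inj₁ S⊆X
  ... | inj₂ (inj₁ X⊆S) = inj₁ (subst (_⊆ᴮ X) (sym (supX S hS S≢M X⊆S)) (⊆-refl {B = X}))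
  ... | inj₂ (inj₂ (k , ap)) with k ≟ᶠ j
  ...   | yes refl = inj₂ ap
  ...   | no k≢j   =
    ⊥-elim (near⇒¬apartᵗ {S = S} {X = X} (member-brick S hS) (member-brick X hX) nS (meets⇒near {S = X} mX) k≢j ap)

  separated : InMax m H R₁ → InMax m H R₂ → R₁ ≢ R₂ → Meets m E R₁ → Meets m E R₂ →
    Apart (a R₁ j) (b R₁ j) (a R₂ j) (b R₂ j)
  separated {R₁} {R₂} (h₁ , R₁≢M , sup₁) i₂@(h₂ , R₂≢M , _) R₁≢R₂ m₁ m₂
    with alongEdge {X = R₂} {S = R₁} i₂ m₂ h₁ R₁≢M (meets⇒near {S = R₁} m₁)
  ... | inj₁ R₁⊆R₂ = ⊥-elim (R₁≢R₂ (sym (sup₁ R₂ h₂ R₂≢M R₁⊆R₂)))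
  ... | inj₂ ap    = ap

  stretch-blocked : ∀ {x y} → InMax m H X → ElementaryCube X → Meets m E X →
    x ≤ a X j → b X j ≤ y → y ≤ lookup m j →
    x ≢ a X j ⊎ y ≢ b X j → x ≢ 0 ⊎ y ≢ lookup m j →
    (∀ S → H S → S ≢ Whole m → Near S → Apart (a S j) (b S j) (a X j) (b X j) →
       Overlap (a S j) (b S j) x y → ⊥) → ⊥
  stretch-blocked {X} {x} {y} iX@(hX , _ , _) cube mX x≤aX bX≤y y≤m proper notWhole blocked =
    enlargement-blocked {B = X} {D = X⁺} iX X⊆X⁺ X⁺-brick X⁺≢M X⁺≢X blocked′
    where
    X⁺ : Brick d
    X⁺ = thinSlab x y (a X)
    X⁺-along : a X⁺ j ≡ x × b X⁺ j ≡ y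
    X⁺-along = slab-along {x} {y} {a X} {suc ∘ a X}
    X-brick : IsBrickOf m X
    X-brick = member-brick X hX
    X-hugs : ∀ i → i ≢ j → a X i ≤ f i × f i ≤ suc (a X i)
    X-hugs i i≢j = proj₁ (mX i i≢j) , subst (f i ≤_) (cube i) (proj₂ (mX i i≢j))
    X⊆X⁺ : X ⊆ᴮ X⁺
    X⊆X⁺ = slab-intro (λ i p q → p ≤ a X i × b X i ≤ q) (x≤aX , bX≤y)
            (λ i _ → ≤-refl , ≤-reflexive (cube i))
    X⁺-brick : IsBrickOf m X⁺
    X⁺-brick = slab-intro (λ i p q → p < q × q ≤ lookup m i)
                (≤-<-trans x≤aX (<-≤-trans (proj₁ (X-brick j)) bX≤y) , y≤m)
                (λ i _ → n<1+n _ , subst (_≤ lookup m i) (cube i) (proj₂ (X-brick i)))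
    X⁺≢X : X⁺ ≢ X
    X⁺≢X = differ-at j (⊎-map (subst (_≢ a X j) (sym (proj₁ X⁺-along)))
                              (subst (_≢ b X j) (sym (proj₂ X⁺-along))) proper)
    X⁺≢M : X⁺ ≢ Whole m
    X⁺≢M = differ-at j (⊎-map (subst₂ _≢_ (sym (proj₁ X⁺-along)) (sym (Whole-a m j)))
                              (subst (_≢ lookup m j) (sym (proj₂ X⁺-along))) notWhole)
    blocked′ : ∀ S → H S → S ≢ Whole m → Disjoint S X → ¬ Touch S X⁺
    blocked′ S hS S≢M (k , ap) t with slab-elim (λ i p q → Overlap (a S i) (b S i) p q) t | k ≟ᶠ j
    ... | (ovj , _) | yes refl = blocked S hS S≢M (touch-thin⇒near {S = S} X-hugs t) ap ovj
    ... | (_ , ovt) | no k≢j   =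
      overlap⇒¬apart (subst (Overlap (a S k) (b S k) (a X k)) (sym (cube k)) (ovt k k≢j)) ap

  module Gap {Lb Rb : Brick d} (iL : InMax m H Lb) (iR : InMax m H Rb)
             (mL : Meets m E Lb) (mR : Meets m E Rb) (g<h : b Lb j < a Rb j)
             (noneBetween : ∀ R → InMax m H R → R ≢ Lb → R ≢ Rb → Meets m E R →
                            a R j < a Rb j → b Lb j < b R j → ⊥) where

    g h : ℕ
    g = b Lb j
    h = a Rb j

    Lb-brick : IsBrickOf m Lb
    Lb-brick = member-brick Lb (proj₁ iL)

    Rb-brick : IsBrickOf m Rb
    Rb-brick = member-brick Rb (proj₁ iR)

    h<m : h < lookup m j
    h<m = <-≤-trans (proj₁ (Rb-brick j)) (proj₂ (Rb-brick j))

    InGap : Brick d → Set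
    InGap B = H B × B ≢ Whole m × Near B × g < a B j × b B j < h

    trapped : H S → S ≢ Whole m → Near S → g < b S j → a S j < h → InGap S
    trapped {S} hS S≢M nS g<bS aS<h = hS , S≢M , nS , g<aS , bS<h
      where
      g<aS : g < a S j
      g<aS with alongEdge {X = Lb} {S = S} iL mL hS S≢M nS
      ... | inj₁ S⊆Lb         = ⊥-elim (<⇒≱ g<bS (proj₂ (S⊆Lb j)))
      ... | inj₂ (inj₁ bS<aL) = ⊥-elim (<⇒≱ g<bS (<⇒≤ (<-trans bS<aL (proj₁ (Lb-brick j)))))
      ... | inj₂ (inj₂ g<aS′) = g<aS′
      bS<h : b S j < h
      bS<h with alongEdge {X = Rb} {S = S} iR mR hS S≢M nS
      ... | inj₁ S⊆Rb         = ⊥-elim (<⇒≱ aS<h (proj₁ (S⊆Rb j)))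
      ... | inj₂ (inj₁ bS<h′) = bS<h′
      ... | inj₂ (inj₂ bR<aS) = ⊥-elim (<⇒≱ aS<h (<⇒≤ (<-trans (proj₁ (Rb-brick j)) bR<aS)))

    -- A member of Max(H) inside the gap does not meet E (gap hypothesis), so
    -- its hull with the line of E is a proper enlargement that H would accept.
    maxInGap⇒⊥ : InMax m H B → InGap B → ⊥
    maxInGap⇒⊥ {B} iB (hB , B≢M , nB , g<aB , bB<h) =
      enlargement-blocked {B = B} {D = hull B} iB (⊆-hull {B = B}) (hull-brick {B = B} bB) hull≢M hull≢B
        (λ S hS _ dj t → hull-touch {B = B} {S = S} bB nB (member-brick S hS) t dj)
      where
      bB : IsBrickOf m B
      bB = member-brick B hB
      hull≢M : hull B ≢ Whole m
      hull≢M = differ-at j (inj₁ (subst₂ _≢_ (sym (hull-along {B = B})) (sym (Whole-a m j))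
                                          (m<n⇒n≢0 g<aB)))
      hull≢B : hull B ≢ B
      hull≢B hull≡B = noneBetween B iB B≢Lb B≢Rb (subst (Meets m E) hull≡B (hull-meets {B = B}))
                        (<-trans (proj₁ (bB j)) bB<h) (<-trans g<aB (proj₁ (bB j)))
        where
        B≢Lb : B ≢ Lb
        B≢Lb refl = <⇒≱ g<aB (<⇒≤ (proj₁ (Lb-brick j)))
        B≢Rb : B ≢ Rb
        B≢Rb refl = <⇒≱ bB<h (<⇒≤ (proj₁ (Rb-brick j)))

    -- A counterexample
    -- with no larger counterexample above it would be in Max(H); induction on
    -- slack supplies such a counterexample.
    nothingInGap : ∀ B → InGap B → ⊥
    nothingInGap B = noneFrom B (<-wellFounded (slack m B))
      where
      noneFrom : ∀ B → Acc _<_ (slack m B) → InGap B → ⊥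
      noneFrom B (acc smaller) inB@(hB , B≢M , nB , g<aB , bB<h) = maxInGap⇒⊥ (hB , B≢M , sup) inB
        where
        bB : IsBrickOf m B
        bB = member-brick B hB
        sup : ∀ S → H S → S ≢ Whole m → B ⊆ᴮ S → S ≡ B
        sup S hS S≢M B⊆S with brick-≟ S B
        ... | yes S≡B = S≡B
        ... | no S≢B  = ⊥-elim (noneFrom S (smaller (slack-shrinks {S = S} {B = B} m (member-brick S hS) B⊆S S≢B))
                          (trapped {S = S} hS S≢M (near-⊆ {B = B} {S = S} nB B⊆S)
                             (<-≤-trans (<-trans g<aB (proj₁ (bB j))) (proj₂ (B⊆S j)))
                             (≤-<-trans (proj₁ (B⊆S j)) (<-trans (proj₁ (bB j)) bB<h))))

    -- The gap has length at most 2: otherwise the corner cube [g+1, g+2] could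
    -- be added to H, since every member of H ∖ {M} touching it lies in the gap.
    gap≤2 : h ≤ 2 + g
    gap≤2 = ≮⇒≥ wide⇒⊥
      where
      K : Brick d
      K = cornerCube (suc g)
      wide⇒⊥ : 2 + g < h → ⊥
      wide⇒⊥ 2+g<h = outside⇒touched {D = K} K-brick K∉H touchers
        where
        K-brick : IsBrickOf m K
        K-brick = cornerCube-brick pos (<⇒≤ (<-trans 2+g<h h<m))
        K∉H : ¬ H K
        K∉H hK = nothingInGap K
          ( hK
          , differ-at j (inj₁ (subst₂ _≢_ (sym (proj₁ cornerCube-along)) (sym (Whole-a m j)) (λ ())))
          , touch-thin⇒near {S = K} cornerCube-hugs (touch-refl {B = K} {m = m} K-brick)
          , subst (g <_) (sym (proj₁ cornerCube-along)) (n<1+n g)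
          , subst (_< h) (sym (proj₂ cornerCube-along)) 2+g<h )
        touchers : ∀ S → H S → S ≢ Whole m → ¬ Touch S K
        touchers S hS S≢M t =
          let (1+g≤bS , aS≤2+g) = subst₂ (Overlap (a S j) (b S j)) (proj₁ cornerCube-along) (proj₂ cornerCube-along) (t j)
          in nothingInGap S (trapped {S = S} hS S≢M (touch-thin⇒near {S = S} cornerCube-hugs t)
                               1+g≤bS (≤-<-trans aS≤2+g 2+g<h))

    -- If the gap has length 2, neither neighbour is an elementary cube: it could
    -- be stretched by one unit into the gap.
    gap2⇒Lb-not-cube : h ≡ 2 + g → ¬ ElementaryCube Lb
    gap2⇒Lb-not-cube h≡2+g cube =
      stretch-blocked {X = Lb} {x = a Lb j} {y = suc g} iL cube mL ≤-refl (n≤1+n g)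
        (<⇒≤ (<-trans 1+g<h h<m)) (inj₂ 1+n≢n) (inj₂ (<⇒≢ (<-trans 1+g<h h<m))) blocked
      where
      1+g<h : suc g < h
      1+g<h = subst (suc g <_) (sym h≡2+g) (n<1+n (suc g))
      blocked : ∀ S → H S → S ≢ Whole m → Near S → Apart (a S j) (b S j) (a Lb j) g →
        Overlap (a S j) (b S j) (a Lb j) (suc g) → ⊥
      blocked S hS S≢M nS (inj₁ bS<aL) (aL≤bS , _)     = <⇒≱ bS<aL aL≤bS
      blocked S hS S≢M nS (inj₂ g<aS)  (_ , aS≤1+g) =
        nothingInGap S (trapped {S = S} hS S≢M nS (<-trans g<aS (proj₁ (member-brick S hS j)))
                                                  (≤-<-trans aS≤1+g 1+g<h))

    gap2⇒Rb-not-cube : h ≡ 2 + g → ¬ ElementaryCube Rb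
    gap2⇒Rb-not-cube h≡2+g cube =
      stretch-blocked {X = Rb} {x = suc g} {y = b Rb j} iR cube mR (<⇒≤ 1+g<h) ≤-refl
        (proj₂ (Rb-brick j)) (inj₁ (<⇒≢ 1+g<h)) (inj₁ (λ ())) blocked
      where
      1+g<h : suc g < h
      1+g<h = subst (suc g <_) (sym h≡2+g) (n<1+n (suc g))
      blocked : ∀ S → H S → S ≢ Whole m → Near S → Apart (a S j) (b S j) h (b Rb j) →
        Overlap (a S j) (b S j) (suc g) (b Rb j) → ⊥
      blocked S hS S≢M nS (inj₁ bS<h)  (1+g≤bS , _) =
        nothingInGap S (trapped {S = S} hS S≢M nS 1+g≤bS (<-trans (proj₁ (member-brick S hS j)) bS<h))
      blocked S hS S≢M nS (inj₂ bR<aS) (_ , aS≤bR)  = <⇒≱ bR<aS aS≤bR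

  orderedCase : InMax m H R₁ → InMax m H R₂ → Meets m E R₁ → Meets m E R₂ → b R₁ j < a R₂ j →
    (∀ R → InMax m H R → R ≢ R₁ → R ≢ R₂ → ¬ MeetsGap m E R₁ R₂ R) →
    GapConclusion R₁ R₂ (gapLength E R₁ R₂)
  orderedCase {R₁} {R₂} i₁ i₂ m₁ m₂ g<h noOther =
    subst (GapConclusion R₁ R₂) (sym length≡)
      ( m≤n+o⇒m∸n≤o h g (≤-trans gap≤2 (≤-reflexive (+-comm 2 g)))
      , λ len≡2 → gap2⇒Lb-not-cube (h≡2+g len≡2) , gap2⇒Rb-not-cube (h≡2+g len≡2) )
    where
    lo≡ : gapLo E R₁ R₂ ≡ b R₁ j
    lo≡ = m≤n⇒m⊓n≡m (<⇒≤ (<-trans g<h (proj₁ (member-brick R₂ (proj₁ i₂) j))))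
    hi≡ : gapHi E R₁ R₂ ≡ a R₂ j
    hi≡ = m≤n⇒m⊔n≡n (<⇒≤ (<-trans (proj₁ (member-brick R₁ (proj₁ i₁) j)) g<h))
    open Gap i₁ i₂ m₁ m₂ g<h (λ R iR R≢R₁ R≢R₂ mR aR<h g<bR →
      noOther R iR R≢R₁ R≢R₂ (mR , subst (a R j <_) (sym hi≡) aR<h , subst (_< b R j) (sym lo≡) g<bR))
    length≡ : gapLength E R₁ R₂ ≡ h ∸ g
    length≡ = cong₂ _∸_ hi≡ lo≡
    h≡2+g : h ∸ g ≡ 2 → h ≡ 2 + g
    h≡2+g len≡2 = trans (sym (m∸n+n≡m (<⇒≤ g<h))) (cong (_+ g) len≡2)

corollary3 : ∀ {d} (m : Vec ℕ d) → (∀ i → 0 < lookup m i) →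
    (H : BrickSet d) → IsMaximalSystem m H →
    (∃ λ R → ∃ λ S → InMax m H R × InMax m H S × R ≢ S) →
    (E : Edge d) (R₁ R₂ : Brick d) →
    InMax m H R₁ → InMax m H R₂ → R₁ ≢ R₂ →
    Meets m E R₁ → Meets m E R₂ →
    (∀ R → InMax m H R → R ≢ R₁ → R ≢ R₂ → ¬ MeetsGap m E R₁ R₂ R) →
    gapLength E R₁ R₂ ≤ 2 ×
    (gapLength E R₁ R₂ ≡ 2 → ¬ ElementaryCube R₁ × ¬ ElementaryCube R₂)
corollary3 m pos H maxH _ E R₁ R₂ i₁ i₂ R₁≢R₂ m₁ m₂ noOther =
  [ (λ R₁<R₂ → orderedCase {R₁ = R₁} {R₂ = R₂} i₁ i₂ m₁ m₂ R₁<R₂ noOther)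
  , (λ R₂<R₁ → subst (GapConclusion R₁ R₂) (gapLength-comm E R₂ R₁)
                 (gapConclusion-swap {R₂ = R₂} {R₁ = R₁}
                   (orderedCase {R₁ = R₂} {R₂ = R₁} i₂ i₁ m₂ m₁ R₂<R₁
                     (λ R iR R≢R₂ R≢R₁ → noOther R iR R≢R₁ R≢R₂ ∘ meetsGap-comm {R₂ = R₂} {R₁ = R₁} {S = R} {m = m} {E = E})))) ]
  (separated {R₁ = R₁} {R₂ = R₂} i₁ i₂ R₁≢R₂ m₁ m₂)
  where open GapArgument m pos {H = H} maxH E
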